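{- Let $p$ be a prime, $k$ a positive integer, and $\mathcal{G}$ a finite set of integers. Then $$\frac1{p^k}\sum_{1\le h_1,\dots,h_k\le p}\left(1-\frac1p\left|(\{h_1,\dots,h_k\}+\mathcal{G})/p\mathbb{Z}\right|\right)=\left(1-\frac{|\mathcal{G}/p\mathbb{Z}|}{p}\right)^k.$$
   Context: $\mathcal{A}+\mathcal{G}=\{a+g:a\in\mathcal{A},g\in\mathcal{G}\}$ is the Minkowski sum, and $|\mathcal{K}/p\mathbb{Z}|$ denotes the number of residue classes modulo $p$ met by the set $\mathcal{K}$. -}

module Defs where

open import Data.Nat using (ℕ; zero; suc; NonZero)
open import Data.Integer using (ℤ; +_) renaming (_+_ to _+ℤ_)
open import Data.Integer.DivMod using (_%ℕ_)
open import Data.Rational using (ℚ; 1ℚ) renaming (_*_ to _*ℚ_; _+_ to _+ℚ_)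
open import Data.List using (List; []; _∷_; map; concatMap; length; filter; upTo; foldr)
open import Data.List.Relation.Unary.Any using (Any)
open import Data.List.Relation.Unary.Any.Properties using ()
open import Data.List.Relation.Unary.Any using (any?)
open import Data.Vec using (Vec; []; _∷_; toList)
open import Relation.Binary.PropositionalEquality using (_≡_)
open import Data.Nat using (_≟_)

tuples : (p k : ℕ) → List (Vec ℕ k)
tuples p zero    = [] ∷ []
tuples p (suc k) = concatMap (λ h → map (h ∷_) (tuples p k)) (map suc (upTo p))

minkowski : List ℤ → List ℤ → List ℤ
minkowski A G = concatMap (λ a → map (a +ℤ_) G) A

residueCount : (p : ℕ) .{{_ : NonZero p}} → List ℤ → ℕ
residueCount p K =
  length (filter (λ r → any? (λ x → (x %ℕ p) ≟ r) K) (upTo p))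

tupleSet : ∀ {k} → Vec ℕ k → List ℤ
tupleSet h = map +_ (toList h)

sumℚ : List ℚ → ℚ
sumℚ = foldr _+ℚ_ (Data.Rational.0ℚ)

_^ℚ_ : ℚ → ℕ → ℚ
q ^ℚ zero  = 1ℚ
q ^ℚ suc n = q *ℚ (q ^ℚ n)

{-# OPTIONS --safe #-}

-- Let m_K(r) ∈ {0,1} indicate that K meets no integer ≡ r (mod p), so that p − |K/pℤ| = Σ_{r<p} m_K(r).
-- The set {h₁,…,h_k} + G is the union of the translates hᵢ + G, so its indicator is the product
-- of the m_{hᵢ+G}(r), and summing over all tuples factorises into (Σ_{h=1}^{p} m_{h+G}(r))^k.
-- As h runs over 1,…,p the residue r − h runs over all residues, so this inner sum equals
-- p − |G/pℤ| for every r. Summing over r gives Σ_h (p − |({h}+G)/pℤ|) = p (p − |G/pℤ|)^k,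
-- which is the identity after division by p^(k+1).

module Submission where

module ListSums where

  open import Data.Nat using (ℕ; zero; suc; _<_; _+_; _*_; _∸_)
  open import Data.Nat.Properties as ℕ using (+-comm; +-assoc; +-identityʳ; +-suc; *-distribˡ-+; *-distribʳ-+; *-zeroʳ; +-cancelˡ-≡)
  open import Data.Nat.ListAction using (sum)
  open import Data.Nat.ListAction.Properties using (sum-++)
  open import Data.List using (List; []; _∷_; _++_; map; concatMap; upTo; length)
  open import Data.List.Properties using (map-++; map-cong; map-cong-local; map-applyUpTo; map-upTo; upTo-∷ʳ)
  import Data.List.Relation.Unary.All as All
  open import Data.List.Relation.Unary.All.Properties using (all-upTo)
  open import Function using (_∘_)
  open import Algebra.Properties.CommutativeSemigroup ℕ.+-commutativeSemigroup using (x∙yz≈y∙xz)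
  open import Relation.Binary.PropositionalEquality

  module _ {A : Set} where

    sum-map-*ˡ : ∀ c (f : A → ℕ) xs → sum (map (λ x → c * f x) xs) ≡ c * sum (map f xs)
    sum-map-*ˡ c f []       = sym (*-zeroʳ c)
    sum-map-*ˡ c f (x ∷ xs) = trans (cong (c * f x +_) (sum-map-*ˡ c f xs)) (sym (*-distribˡ-+ c (f x) _))

    sum-map-*ʳ : ∀ c (f : A → ℕ) xs → sum (map (λ x → f x * c) xs) ≡ sum (map f xs) * c
    sum-map-*ʳ c f []       = refl
    sum-map-*ʳ c f (x ∷ xs) = trans (cong (f x * c +_) (sum-map-*ʳ c f xs)) (sym (*-distribʳ-+ c (f x) _))

    sum-map-+ : ∀ (f g : A → ℕ) xs → sum (map (λ x → f x + g x) xs) ≡ sum (map f xs) + sum (map g xs)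
    sum-map-+ f g []       = refl
    sum-map-+ f g (x ∷ xs) = begin
      f x + g x + sum (map (λ x → f x + g x) xs)          ≡⟨ cong (f x + g x +_) (sum-map-+ f g xs) ⟩
      f x + g x + (sum (map f xs) + sum (map g xs))       ≡⟨ +-assoc (f x) (g x) _ ⟩
      f x + (g x + (sum (map f xs) + sum (map g xs)))     ≡⟨ cong (f x +_) (x∙yz≈y∙xz (g x) (sum (map f xs)) (sum (map g xs))) ⟩
      f x + (sum (map f xs) + (g x + sum (map g xs)))     ≡⟨ sym (+-assoc (f x) _ _) ⟩
      f x + sum (map f xs) + (g x + sum (map g xs))       ∎
      where open ≡-Reasoning

    sum-map-const : ∀ c (xs : List A) → sum (map (λ _ → c) xs) ≡ length xs * c
    sum-map-const c []       = refl
    sum-map-const c (x ∷ xs) = cong (c +_) (sum-map-const c xs)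

    sum-map-concatMap : ∀ {B : Set} (f : B → ℕ) (g : A → List B) xs →
                        sum (map f (concatMap g xs)) ≡ sum (map (λ x → sum (map f (g x))) xs)
    sum-map-concatMap f g []       = refl
    sum-map-concatMap f g (x ∷ xs) = begin
      sum (map f (g x ++ concatMap g xs))                     ≡⟨ cong sum (map-++ f (g x) _) ⟩
      sum (map f (g x) ++ map f (concatMap g xs))             ≡⟨ sum-++ (map f (g x)) _ ⟩
      sum (map f (g x)) + sum (map f (concatMap g xs))        ≡⟨ cong (sum (map f (g x)) +_) (sum-map-concatMap f g xs) ⟩
      sum (map f (g x)) + sum (map (λ x → sum (map f (g x))) xs) ∎
      where open ≡-Reasoning

  sum-map-comm : ∀ {A B : Set} (f : A → B → ℕ) xs ys →
                 sum (map (λ x → sum (map (f x) ys)) xs) ≡ sum (map (λ y → sum (map (λ x → f x y) xs)) ys)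
  sum-map-comm f []       ys = trans (sym (*-zeroʳ (length ys))) (sym (sum-map-const 0 ys))
  sum-map-comm f (x ∷ xs) ys = trans (cong (sum (map (f x) ys) +_) (sum-map-comm f xs ys))
                                     (sym (sum-map-+ (f x) (λ y → sum (map (λ x → f x y) xs)) ys))

  sum-upTo-cong : ∀ {n} {f g : ℕ → ℕ} → (∀ {i} → i < n → f i ≡ g i) → sum (map f (upTo n)) ≡ sum (map g (upTo n))
  sum-upTo-cong {n} f≗g = cong sum (map-cong-local (All.map f≗g (all-upTo n)))

  sum-upTo-sucˡ : ∀ (f : ℕ → ℕ) n → sum (map f (upTo (suc n))) ≡ f 0 + sum (map (f ∘ suc) (upTo n))
  sum-upTo-sucˡ f n = cong (f 0 +_) (cong sum (trans (map-applyUpTo suc f n) (sym (map-upTo (f ∘ suc) n))))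

  sum-upTo-sucʳ : ∀ (f : ℕ → ℕ) n → sum (map f (upTo (suc n))) ≡ sum (map f (upTo n)) + f n
  sum-upTo-sucʳ f n = begin
    sum (map f (upTo (suc n)))               ≡⟨ cong (sum ∘ map f) (sym (upTo-∷ʳ n)) ⟩
    sum (map f (upTo n ++ n ∷ []))           ≡⟨ cong sum (map-++ f (upTo n) _) ⟩
    sum (map f (upTo n) ++ f n ∷ [])         ≡⟨ sum-++ (map f (upTo n)) _ ⟩
    sum (map f (upTo n)) + (f n + 0)         ≡⟨ cong (sum (map f (upTo n)) +_) (+-identityʳ (f n)) ⟩
    sum (map f (upTo n)) + f n               ∎
    where open ≡-Reasoning

  sum-upTo-reflect : ∀ (f : ℕ → ℕ) n → sum (map (λ j → f (n ∸ suc j)) (upTo n)) ≡ sum (map f (upTo n))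
  sum-upTo-reflect f zero    = refl
  sum-upTo-reflect f (suc n) = begin
    sum (map (λ j → f (suc n ∸ suc j)) (upTo (suc n)))  ≡⟨ sum-upTo-sucˡ (λ j → f (suc n ∸ suc j)) n ⟩
    f n + sum (map (λ j → f (n ∸ suc j)) (upTo n))      ≡⟨ cong (f n +_) (sum-upTo-reflect f n) ⟩
    f n + sum (map f (upTo n))                          ≡⟨ +-comm (f n) _ ⟩
    sum (map f (upTo n)) + f n                          ≡⟨ sym (sum-upTo-sucʳ f n) ⟩
    sum (map f (upTo (suc n)))                          ∎
    where open ≡-Reasoning

  sum-upTo-rotate : ∀ (f : ℕ → ℕ) n → f n ≡ f 0 → sum (map (f ∘ suc) (upTo n)) ≡ sum (map f (upTo n))
  sum-upTo-rotate f n fn≡f0 = +-cancelˡ-≡ (f 0) _ _ (begin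
    f 0 + sum (map (f ∘ suc) (upTo n))   ≡⟨ sym (sum-upTo-sucˡ f n) ⟩
    sum (map f (upTo (suc n)))           ≡⟨ sum-upTo-sucʳ f n ⟩
    sum (map f (upTo n)) + f n           ≡⟨ cong (sum (map f (upTo n)) +_) fn≡f0 ⟩
    sum (map f (upTo n)) + f 0           ≡⟨ +-comm _ (f 0) ⟩
    f 0 + sum (map f (upTo n))           ∎)
    where open ≡-Reasoning

  sum-upTo-periodic : ∀ (f : ℕ → ℕ) n → (∀ x → f (x + n) ≡ f x) →
                      ∀ a → sum (map (λ j → f (j + a)) (upTo n)) ≡ sum (map f (upTo n))
  sum-upTo-periodic f n f-periodic zero    = cong sum (map-cong (λ j → cong f (+-identityʳ j)) (upTo n))
  sum-upTo-periodic f n f-periodic (suc a) = begin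
    sum (map (λ j → f (j + suc a)) (upTo n))   ≡⟨ cong sum (map-cong (λ j → cong f (+-suc j a)) (upTo n)) ⟩
    sum (map (λ j → f (suc j + a)) (upTo n))   ≡⟨ sum-upTo-rotate (λ j → f (j + a)) n (trans (cong f (+-comm n a)) (f-periodic a)) ⟩
    sum (map (λ j → f (j + a)) (upTo n))       ≡⟨ sum-upTo-periodic f n f-periodic a ⟩
    sum (map f (upTo n))                       ∎
    where open ≡-Reasoning

module IntegerResidues where

  open import Data.Nat using (ℕ; NonZero; _<_; _+_; _%_)
  import Data.Nat.Properties as ℕ
  open import Data.Nat.DivMod using (%-distribˡ-+; m%n%n≡m%n; [m+n]%n≡m%n; m<n⇒m%n≡m)
  open import Data.Nat.Divisibility using (_∣_; divides; n∣m⇒m%n≡0)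
  open import Data.Integer as ℤ using (ℤ; +_; ∣_∣)
  open import Data.Integer.DivMod using (_%ℕ_; _/ℕ_; n%ℕd<d; a≡a%ℕn+[a/ℕn]*n)
  import Data.Integer.Properties as ℤ
  open import Data.Integer.Solver using (module +-*-Solver)
  open import Relation.Binary.PropositionalEquality
  open import Function using (_⇔_; mk⇔)
  open ≡-Reasoning
  open +-*-Solver

  m∣n∧n<m⇒n≡0 : ∀ {m n} .{{_ : NonZero m}} → m ∣ n → n < m → n ≡ 0
  m∣n∧n<m⇒n≡0 {m} {n} m∣n n<m = trans (sym (m<n⇒m%n≡m n<m)) (n∣m⇒m%n≡0 n m m∣n)

  %ℕ-unique : ∀ {n} .{{_ : NonZero n}} {i : ℤ} r q → r < n → i ≡ + r ℤ.+ q ℤ.* + n → i %ℕ n ≡ r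
  %ℕ-unique {n} {i} r q r<n i≡r+qn = sym (ℤ.+-injective (ℤ.i-j≡0⇒i≡j (+ r) (+ r′) r-r′≡0))
    where
    r′ : ℕ
    r′ = i %ℕ n
    q′ : ℤ
    q′ = i /ℕ n
    r-r′≡[q′-q]n : + r ℤ.- + r′ ≡ (q′ ℤ.- q) ℤ.* + n
    r-r′≡[q′-q]n = begin
      + r ℤ.- + r′                                   ≡⟨ solve 4 (λ r r′ q n → r :- r′ := (r :+ q :* n) :- (r′ :+ q :* n)) refl (+ r) (+ r′) q (+ n) ⟩
      (+ r ℤ.+ q ℤ.* + n) ℤ.- (+ r′ ℤ.+ q ℤ.* + n)   ≡⟨ cong (ℤ._- (+ r′ ℤ.+ q ℤ.* + n)) (sym i≡r+qn) ⟩
      i ℤ.- (+ r′ ℤ.+ q ℤ.* + n)                     ≡⟨ cong (ℤ._- (+ r′ ℤ.+ q ℤ.* + n)) (a≡a%ℕn+[a/ℕn]*n i n) ⟩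
      (+ r′ ℤ.+ q′ ℤ.* + n) ℤ.- (+ r′ ℤ.+ q ℤ.* + n) ≡⟨ solve 4 (λ r′ q q′ n → (r′ :+ q′ :* n) :- (r′ :+ q :* n) := (q′ :- q) :* n) refl (+ r′) q q′ (+ n) ⟩
      (q′ ℤ.- q) ℤ.* + n                             ∎
    n∣∣r-r′∣ : n ∣ ∣ + r ℤ.- + r′ ∣
    n∣∣r-r′∣ = divides ∣ q′ ℤ.- q ∣ (trans (cong ∣_∣ r-r′≡[q′-q]n) (ℤ.abs-* (q′ ℤ.- q) (+ n)))
    ∣r-r′∣<n : ∣ + r ℤ.- + r′ ∣ < n
    ∣r-r′∣<n rewrite ℤ.[+m]-[+n]≡m⊖n r r′ = ℕ.≤-<-trans (ℤ.∣m⊝n∣≤m⊔n r r′) (ℕ.⊔-lub r<n (n%ℕd<d i n))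
    r-r′≡0 : + r ℤ.- + r′ ≡ + 0
    r-r′≡0 = ℤ.∣i∣≡0⇒i≡0 (m∣n∧n<m⇒n≡0 n∣∣r-r′∣ ∣r-r′∣<n)

  [i+j*n]%ℕn≡i%ℕn : ∀ {n} .{{_ : NonZero n}} i j → (i ℤ.+ j ℤ.* + n) %ℕ n ≡ i %ℕ n
  [i+j*n]%ℕn≡i%ℕn {n} i j = %ℕ-unique (i %ℕ n) (i /ℕ n ℤ.+ j) (n%ℕd<d i n) (begin
    i ℤ.+ j ℤ.* + n                                 ≡⟨ cong (ℤ._+ j ℤ.* + n) (a≡a%ℕn+[a/ℕn]*n i n) ⟩
    + (i %ℕ n) ℤ.+ i /ℕ n ℤ.* + n ℤ.+ j ℤ.* + n     ≡⟨ solve 4 (λ r q j n → r :+ q :* n :+ j :* n := r :+ (q :+ j) :* n) refl (+ (i %ℕ n)) (i /ℕ n) j (+ n) ⟩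
    + (i %ℕ n) ℤ.+ (i /ℕ n ℤ.+ j) ℤ.* + n           ∎)

  [+m+i]%ℕn≡[m+i%ℕn]%n : ∀ {n} .{{_ : NonZero n}} m i → (+ m ℤ.+ i) %ℕ n ≡ (m + i %ℕ n) % n
  [+m+i]%ℕn≡[m+i%ℕn]%n {n} m i = begin
    (+ m ℤ.+ i) %ℕ n                                ≡⟨ cong (λ z → (+ m ℤ.+ z) %ℕ n) (a≡a%ℕn+[a/ℕn]*n i n) ⟩
    (+ m ℤ.+ (+ (i %ℕ n) ℤ.+ i /ℕ n ℤ.* + n)) %ℕ n  ≡⟨ cong (_%ℕ n) (sym (ℤ.+-assoc (+ m) (+ (i %ℕ n)) (i /ℕ n ℤ.* + n))) ⟩
    (+ (m + i %ℕ n) ℤ.+ i /ℕ n ℤ.* + n) %ℕ n        ≡⟨ [i+j*n]%ℕn≡i%ℕn (+ (m + i %ℕ n)) (i /ℕ n) ⟩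
    (m + i %ℕ n) % n                                ∎

  [m+n%d]%d≡[m+n]%d : ∀ m n d .{{_ : NonZero d}} → (m + n % d) % d ≡ (m + n) % d
  [m+n%d]%d≡[m+n]%d m n d = begin
    (m + n % d) % d           ≡⟨ %-distribˡ-+ m (n % d) d ⟩
    (m % d + n % d % d) % d   ≡⟨ cong (λ z → (m % d + z) % d) (m%n%n≡m%n n d) ⟩
    (m % d + n % d) % d       ≡⟨ sym (%-distribˡ-+ m n d) ⟩
    (m + n) % d               ∎

  [u+[t+s]%n]%n≡s : ∀ {n} .{{_ : NonZero n}} {t u} s → u + t ≡ n → s < n → (u + (t + s) % n) % n ≡ s
  [u+[t+s]%n]%n≡s {n} {t} {u} s u+t≡n s<n = begin
    (u + (t + s) % n) % n    ≡⟨ [m+n%d]%d≡[m+n]%d u (t + s) n ⟩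
    (u + (t + s)) % n        ≡⟨ cong (_% n) (sym (ℕ.+-assoc u t s)) ⟩
    (u + t + s) % n          ≡⟨ cong (λ z → (z + s) % n) u+t≡n ⟩
    (n + s) % n              ≡⟨ cong (_% n) (ℕ.+-comm n s) ⟩
    (s + n) % n              ≡⟨ [m+n]%n≡m%n s n ⟩
    s % n                    ≡⟨ m<n⇒m%n≡m s<n ⟩
    s                        ∎

  shift-residue : ∀ {n} .{{_ : NonZero n}} {t u r} → t + u ≡ n → r < n →
                  ∀ x → ((+ t ℤ.+ x) %ℕ n ≡ r) ⇔ (x %ℕ n ≡ (u + r) % n)
  shift-residue {n} {t} {u} {r} t+u≡n r<n x = mk⇔ to from
    where
    s : ℕ
    s = x %ℕ n
    to : (+ t ℤ.+ x) %ℕ n ≡ r → s ≡ (u + r) % n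
    to e = sym (trans (cong (λ z → (u + z) % n) (trans (sym e) ([+m+i]%ℕn≡[m+i%ℕn]%n t x)))
                      ([u+[t+s]%n]%n≡s s (trans (ℕ.+-comm u t) t+u≡n) (n%ℕd<d x n)))
    from : s ≡ (u + r) % n → (+ t ℤ.+ x) %ℕ n ≡ r
    from e = trans ([+m+i]%ℕn≡[m+i%ℕn]%n t x)
                   (trans (cong (λ z → (t + z) % n) e) ([u+[t+s]%n]%n≡s r t+u≡n r<n))

module ResidueCounting where

  open import Defs using (tuples; minkowski; tupleSet; residueCount)
  open import Data.Nat using (ℕ; zero; suc; NonZero; _<_; _+_; _*_; _^_; _∸_; _%_; _≟_)
  open import Data.Nat.Properties using (+-suc; +-identityʳ; m+[n∸m]≡n)
  open import Data.Nat.DivMod using ([m+n]%n≡m%n; m<n⇒m%n≡m)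
  open import Data.Nat.ListAction using (sum; product)
  open import Data.Integer using (ℤ; +_) renaming (_+_ to _+ℤ_)
  open import Data.Integer.DivMod using (_%ℕ_)
  open import Data.Bool using (Bool; true; false; _∨_)
  open import Data.Bool.Properties using (∨-assoc)
  open import Data.List using (List; []; _∷_; _++_; map; concatMap; filter; length; upTo)
  open import Data.List.Properties using (map-cong; map-∘; length-upTo)
  open import Data.List.Relation.Unary.Any as Any using (Any; any?)
  open import Data.List.Relation.Unary.Any.Properties using (map⁺; map⁻)
  open import Data.Vec using (Vec; []; _∷_; toList)
  open import Relation.Nullary using (Dec; does)
  open import Relation.Nullary.Decidable using (does-⇔)
  open import Relation.Unary using (Decidable)
  open import Function using (_∘_; _⇔_; mk⇔; Equivalence)
  open import Relation.Binary.PropositionalEquality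
  open ListSums
  open IntegerResidues

  [¬_] : Bool → ℕ
  [¬ true  ] = 0
  [¬ false ] = 1

  [¬a∨b]≡[¬a]*[¬b] : ∀ a b → [¬ a ∨ b ] ≡ [¬ a ] * [¬ b ]
  [¬a∨b]≡[¬a]*[¬b] true  b = refl
  [¬a∨b]≡[¬a]*[¬b] false b = sym (+-identityʳ [¬ b ])

  length-filter+rejected≡length : ∀ {A : Set} {P : A → Set} (P? : Decidable P) xs →
    length (filter P? xs) + sum (map (λ x → [¬ does (P? x) ]) xs) ≡ length xs
  length-filter+rejected≡length P? []       = refl
  length-filter+rejected≡length P? (x ∷ xs) with does (P? x)
  ... | true  = cong suc (length-filter+rejected≡length P? xs)
  ... | false = trans (+-suc _ _) (cong suc (length-filter+rejected≡length P? xs))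

  does-any?-++ : ∀ {A : Set} {P : A → Set} (P? : Decidable P) xs ys →
    does (any? P? (xs ++ ys)) ≡ does (any? P? xs) ∨ does (any? P? ys)
  does-any?-++ P? []       ys = refl
  does-any?-++ P? (x ∷ xs) ys =
    trans (cong (does (P? x) ∨_) (does-any?-++ P? xs ys)) (sym (∨-assoc (does (P? x)) _ _))

  sum-tuples-product : ∀ p k (f : ℕ → ℕ) →
    sum (map (λ h → product (map f (toList h))) (tuples p k)) ≡ sum (map f (map suc (upTo p))) ^ k
  sum-tuples-product p zero    f = refl
  sum-tuples-product p (suc k) f = begin
    sum (map Π (concatMap (λ h → map (h ∷_) T) L))   ≡⟨ sum-map-concatMap Π (λ h → map (h ∷_) T) L ⟩
    sum (map (λ h → sum (map Π (map (h ∷_) T))) L)   ≡⟨ cong sum (map-cong row L) ⟩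
    sum (map (λ h → f h * S ^ k) L)                  ≡⟨ sum-map-*ʳ (S ^ k) f L ⟩
    S * S ^ k                                        ∎
    where
    open ≡-Reasoning
    Π : ∀ {n} → Vec ℕ n → ℕ
    Π h = product (map f (toList h))
    T : List (Vec ℕ k)
    T = tuples p k
    L : List ℕ
    L = map suc (upTo p)
    S : ℕ
    S = sum (map f L)
    row : ∀ h → sum (map Π (map (h ∷_) T)) ≡ f h * S ^ k
    row h = begin
      sum (map Π (map (h ∷_) T))         ≡⟨ cong sum (sym (map-∘ T)) ⟩
      sum (map (λ hs → f h * Π hs) T)    ≡⟨ sum-map-*ˡ (f h) Π T ⟩
      f h * sum (map Π T)                ≡⟨ cong (f h *_) (sum-tuples-product p k f) ⟩
      f h * S ^ k                        ∎

  module _ (p : ℕ) .{{_ : NonZero p}} where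

    meets? : (K : List ℤ) (r : ℕ) → Dec (Any (λ x → x %ℕ p ≡ r) K)
    meets? K r = any? (λ x → x %ℕ p ≟ r) K

    misses : List ℤ → ℕ → ℕ
    misses K r = [¬ does (meets? K r) ]

    missCount : List ℤ → ℕ
    missCount K = sum (map (misses K) (upTo p))

    residueCount+missCount≡p : ∀ K → residueCount p K + missCount K ≡ p
    residueCount+missCount≡p K = trans (length-filter+rejected≡length (meets? K) (upTo p)) (length-upTo p)

    misses-++ : ∀ A B r → misses (A ++ B) r ≡ misses A r * misses B r
    misses-++ A B r = trans (cong [¬_] (does-any?-++ (λ x → x %ℕ p ≟ r) A B))
                            ([¬a∨b]≡[¬a]*[¬b] (does (meets? A r)) (does (meets? B r)))

    misses-minkowski : ∀ {k} (h : Vec ℕ k) G r →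
      misses (minkowski (tupleSet h) G) r ≡ product (map (λ t → misses (map (+ t +ℤ_) G) r) (toList h))
    misses-minkowski []      G r = refl
    misses-minkowski (t ∷ h) G r =
      trans (misses-++ (map (+ t +ℤ_) G) _ r) (cong (misses (map (+ t +ℤ_) G) r *_) (misses-minkowski h G r))

    misses-shift : ∀ {t u r} → t + u ≡ p → r < p → ∀ G → misses (map (+ t +ℤ_) G) r ≡ misses G ((u + r) % p)
    misses-shift {t} {u} {r} t+u≡p r<p G =
      cong [¬_] (does-⇔ meets-shifted (meets? (map (+ t +ℤ_) G) r) (meets? G ((u + r) % p)))
      where
      meets-shifted : Any (λ y → y %ℕ p ≡ r) (map (+ t +ℤ_) G) ⇔ Any (λ x → x %ℕ p ≡ (u + r) % p) G
      meets-shifted = mk⇔ (Any.map (λ {x} → Equivalence.to (shift-residue t+u≡p r<p x)) ∘ map⁻)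
                          (map⁺ ∘ Any.map (λ {x} → Equivalence.from (shift-residue t+u≡p r<p x)))

    sum-misses-shifts≡missCount : ∀ G {r} → r < p →
      sum (map (λ t → misses (map (+ t +ℤ_) G) r) (map suc (upTo p))) ≡ missCount G
    sum-misses-shifts≡missCount G {r} r<p = begin
      sum (map (λ t → misses (map (+ t +ℤ_) G) r) (map suc (upTo p)))  ≡⟨ cong sum (sym (map-∘ (upTo p))) ⟩
      sum (map (λ j → misses (map (+ suc j +ℤ_) G) r) (upTo p))       ≡⟨ sum-upTo-cong (λ j<p → misses-shift (m+[n∸m]≡n j<p) r<p G) ⟩
      sum (map (λ j → F (p ∸ suc j + r)) (upTo p))                     ≡⟨ sum-upTo-reflect (λ u → F (u + r)) p ⟩
      sum (map (λ u → F (u + r)) (upTo p))                             ≡⟨ sum-upTo-periodic F p (λ y → cong (misses G) ([m+n]%n≡m%n y p)) r ⟩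
      sum (map F (upTo p))                                             ≡⟨ sum-upTo-cong (λ u<p → cong (misses G) (m<n⇒m%n≡m u<p)) ⟩
      missCount G                                                      ∎
      where
      open ≡-Reasoning
      F : ℕ → ℕ
      F y = misses G (y % p)

    sum-missCount-minkowski : ∀ k G →
      sum (map (λ h → missCount (minkowski (tupleSet h) G)) (tuples p k)) ≡ p * missCount G ^ k
    sum-missCount-minkowski k G = begin
      sum (map (λ h → sum (map (misses (M h)) (upTo p))) T)          ≡⟨ sum-map-comm (λ h r → misses (M h) r) T (upTo p) ⟩
      sum (map (λ r → sum (map (λ h → misses (M h) r) T)) (upTo p))  ≡⟨ cong sum (map-cong column (upTo p)) ⟩
      sum (map (λ r → A r ^ k) (upTo p))                             ≡⟨ sum-upTo-cong (λ r<p → cong (_^ k) (sum-misses-shifts≡missCount G r<p)) ⟩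
      sum (map (λ _ → missCount G ^ k) (upTo p))                     ≡⟨ sum-map-const (missCount G ^ k) (upTo p) ⟩
      length (upTo p) * missCount G ^ k                              ≡⟨ cong (_* missCount G ^ k) (length-upTo p) ⟩
      p * missCount G ^ k                                            ∎
      where
      open ≡-Reasoning
      T : List (Vec ℕ k)
      T = tuples p k
      M : Vec ℕ k → List ℤ
      M h = minkowski (tupleSet h) G
      A : ℕ → ℕ
      A r = sum (map (λ t → misses (map (+ t +ℤ_) G) r) (map suc (upTo p)))
      column : ∀ r → sum (map (λ h → misses (M h) r) T) ≡ A r ^ k
      column r = trans (cong sum (map-cong (λ h → misses-minkowski h G r) T))
                       (sum-tuples-product p k (λ t → misses (map (+ t +ℤ_) G) r))

module RationalArithmetic where

  open import Defs using (sumℚ; _^ℚ_)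
  open import Data.Nat as ℕ using (ℕ; zero; suc; NonZero)
  open import Data.Nat.Properties as ℕ using (m^n≢0; m*n≢0)
  open import Data.Nat.ListAction using (sum)
  open import Data.Integer as ℤ using (+_)
  import Data.Integer.Properties as ℤ
  open import Data.Rational using (ℚ; 1ℚ; _/_; _+_; _*_; _-_; toℚᵘ)
  open import Data.Rational.Properties
    using (toℚᵘ-injective; toℚᵘ-fromℚᵘ; toℚᵘ-homo-*; toℚᵘ-homo-+; /-cong; *-zeroʳ; *-distribˡ-+; *-assoc; *-identityˡ)
  open import Data.Rational.Unnormalised as ℚᵘ using (*≡*)
  import Data.Rational.Unnormalised.Properties as ℚᵘ
  open import Data.Rational.Solver using (module +-*-Solver)
  open import Data.List using (List; []; _∷_; map)
  open import Data.List.Properties using (map-cong)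
  open import Function using (_∘_)
  open import Relation.Binary.PropositionalEquality

  fromℕ : ℕ → ℚ
  fromℕ n = + n / 1

  toℚᵘ-/ : ∀ i n .{{_ : NonZero n}} → toℚᵘ (i / n) ℚᵘ.≃ i ℚᵘ./ n
  toℚᵘ-/ i (suc n) = toℚᵘ-fromℚᵘ (i ℚᵘ./ suc n)

  /-homo-* : ∀ a b c d .{{_ : NonZero b}} .{{_ : NonZero d}} →
             (+ a / b) * (+ c / d) ≡ (+ (a ℕ.* c) / (b ℕ.* d)) {{m*n≢0 b d}}
  /-homo-* a b@(suc _) c d@(suc _) = toℚᵘ-injective (begin
    toℚᵘ ((+ a / b) * (+ c / d))         ≈⟨ toℚᵘ-homo-* (+ a / b) (+ c / d) ⟩
    toℚᵘ (+ a / b) ℚᵘ.* toℚᵘ (+ c / d)   ≈⟨ ℚᵘ.*-cong (toℚᵘ-/ (+ a) b) (toℚᵘ-/ (+ c) d) ⟩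
    (+ a ℚᵘ./ b) ℚᵘ.* (+ c ℚᵘ./ d)       ≡⟨ cong (ℚᵘ._/ (b ℕ.* d)) (sym (ℤ.pos-* a c)) ⟩
    + (a ℕ.* c) ℚᵘ./ (b ℕ.* d)           ≈⟨ ℚᵘ.≃-sym (toℚᵘ-/ (+ (a ℕ.* c)) (b ℕ.* d)) ⟩
    toℚᵘ (+ (a ℕ.* c) / (b ℕ.* d))       ∎)
    where open ℚᵘ.≃-Reasoning

  fromℕ-homo-+ : ∀ m n → fromℕ (m ℕ.+ n) ≡ fromℕ m + fromℕ n
  fromℕ-homo-+ m n = toℚᵘ-injective (begin
    toℚᵘ (fromℕ (m ℕ.+ n))                 ≈⟨ toℚᵘ-/ (+ (m ℕ.+ n)) 1 ⟩
    + (m ℕ.+ n) ℚᵘ./ 1                     ≡⟨ cong (ℚᵘ._/ 1) numerator ⟩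
    (+ m ℚᵘ./ 1) ℚᵘ.+ (+ n ℚᵘ./ 1)         ≈⟨ ℚᵘ.≃-sym (ℚᵘ.+-cong (toℚᵘ-/ (+ m) 1) (toℚᵘ-/ (+ n) 1)) ⟩
    toℚᵘ (fromℕ m) ℚᵘ.+ toℚᵘ (fromℕ n)     ≈⟨ ℚᵘ.≃-sym (toℚᵘ-homo-+ (fromℕ m) (fromℕ n)) ⟩
    toℚᵘ (fromℕ m + fromℕ n)               ∎)
    where
    open ℚᵘ.≃-Reasoning
    numerator : + (m ℕ.+ n) ≡ + m ℤ.* + 1 ℤ.+ + n ℤ.* + 1
    numerator = trans (ℤ.pos-+ m n) (sym (cong₂ ℤ._+_ (ℤ.*-identityʳ (+ m)) (ℤ.*-identityʳ (+ n))))

  fromℕ-homo-* : ∀ m n → fromℕ (m ℕ.* n) ≡ fromℕ m * fromℕ n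
  fromℕ-homo-* m n = sym (/-homo-* m 1 n 1)

  fromℕ-homo-^ : ∀ m k → fromℕ (m ℕ.^ k) ≡ fromℕ m ^ℚ k
  fromℕ-homo-^ m zero    = refl
  fromℕ-homo-^ m (suc k) = trans (fromℕ-homo-* m (m ℕ.^ k)) (cong (fromℕ m *_) (fromℕ-homo-^ m k))

  1/[m^k]≡[1/m]^k : ∀ m k .{{_ : NonZero m}} → (+ 1 / (m ℕ.^ k)) {{m^n≢0 m k}} ≡ (+ 1 / m) ^ℚ k
  1/[m^k]≡[1/m]^k m zero    = refl
  1/[m^k]≡[1/m]^k m (suc k) {{m≢0}} =
    trans (sym (/-homo-* 1 m 1 (m ℕ.^ k) {{m≢0}} {{m^n≢0 m k}})) (cong ((+ 1 / m) *_) (1/[m^k]≡[1/m]^k m k))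

  m/n≡1/n*m : ∀ m n .{{_ : NonZero n}} → + m / n ≡ (+ 1 / n) * fromℕ m
  m/n≡1/n*m m n = sym (trans (/-homo-* 1 n m 1) (/-cong {{m*n≢0 n 1}} (cong +_ (ℕ.*-identityˡ m)) (ℕ.*-identityʳ n)))

  1/n*n≡1 : ∀ n .{{_ : NonZero n}} → (+ 1 / n) * fromℕ n ≡ 1ℚ
  1/n*n≡1 n@(suc _) = trans (sym (m/n≡1/n*m n n)) (toℚᵘ-injective (begin
    toℚᵘ (+ n / n)     ≈⟨ toℚᵘ-/ (+ n) n ⟩
    + n ℚᵘ./ n         ≈⟨ *≡* (ℤ.*-comm (+ n) (+ 1)) ⟩
    ℚᵘ.1ℚᵘ             ≈⟨ ℚᵘ.≃-sym (toℚᵘ-/ (+ 1) 1) ⟩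
    toℚᵘ 1ℚ            ∎))
    where open ℚᵘ.≃-Reasoning

  ^ℚ-distrib-* : ∀ p q k → (p * q) ^ℚ k ≡ p ^ℚ k * q ^ℚ k
  ^ℚ-distrib-* p q zero    = refl
  ^ℚ-distrib-* p q (suc k) = trans (cong ((p * q) *_) (^ℚ-distrib-* p q k))
    (solve 4 (λ p q x y → (p :* q) :* (x :* y) := (p :* x) :* (q :* y)) refl p q (p ^ℚ k) (q ^ℚ k))
    where open +-*-Solver

  sumℚ-map-fromℕ : ∀ {A : Set} (f : A → ℕ) xs → sumℚ (map (λ x → fromℕ (f x)) xs) ≡ fromℕ (sum (map f xs))
  sumℚ-map-fromℕ f []       = refl
  sumℚ-map-fromℕ f (x ∷ xs) = trans (cong (_+_ (fromℕ (f x))) (sumℚ-map-fromℕ f xs)) (sym (fromℕ-homo-+ (f x) _))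

  sumℚ-map-*ˡ : ∀ {A : Set} q (f : A → ℚ) xs → sumℚ (map (λ x → q * f x) xs) ≡ q * sumℚ (map f xs)
  sumℚ-map-*ˡ q f []       = sym (*-zeroʳ q)
  sumℚ-map-*ˡ q f (x ∷ xs) = trans (cong (_+_ (q * f x)) (sumℚ-map-*ˡ q f xs)) (sym (*-distribˡ-+ q (f x) _))

  1/n*[n*m]≡m : ∀ n m .{{_ : NonZero n}} → (+ 1 / n) * fromℕ (n ℕ.* m) ≡ fromℕ m
  1/n*[n*m]≡m n m = begin
    (+ 1 / n) * fromℕ (n ℕ.* m)         ≡⟨ cong ((+ 1 / n) *_) (fromℕ-homo-* n m) ⟩
    (+ 1 / n) * (fromℕ n * fromℕ m)     ≡⟨ sym (*-assoc (+ 1 / n) (fromℕ n) (fromℕ m)) ⟩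
    (+ 1 / n) * fromℕ n * fromℕ m       ≡⟨ cong (_* fromℕ m) (1/n*n≡1 n) ⟩
    1ℚ * fromℕ m                        ≡⟨ *-identityˡ (fromℕ m) ⟩
    fromℕ m                             ∎
    where open ≡-Reasoning

  1-c/n≡d/n : ∀ {n} .{{_ : NonZero n}} c d → c ℕ.+ d ≡ n → 1ℚ - (+ 1 / n) * fromℕ c ≡ (+ 1 / n) * fromℕ d
  1-c/n≡d/n {n} c d c+d≡n = begin
    1ℚ - u * fromℕ c                        ≡⟨ cong (_- u * fromℕ c) (sym (1/n*n≡1 n)) ⟩
    u * fromℕ n - u * fromℕ c               ≡⟨ cong (λ m → u * fromℕ m - u * fromℕ c) (sym c+d≡n) ⟩
    u * fromℕ (c ℕ.+ d) - u * fromℕ c       ≡⟨ cong (λ x → u * x - u * fromℕ c) (fromℕ-homo-+ c d) ⟩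
    u * (fromℕ c + fromℕ d) - u * fromℕ c   ≡⟨ solve 3 (λ u x y → u :* (x :+ y) :- u :* x := u :* y) refl u (fromℕ c) (fromℕ d) ⟩
    u * fromℕ d                             ∎
    where
    open ≡-Reasoning
    open +-*-Solver
    u : ℚ
    u = + 1 / n

  [1/n^k]*Σ[1-c/n]≡[1-g/n]^k : ∀ {A : Set} n k .{{_ : NonZero n}} (xs : List A) (c d : A → ℕ) {g m} →
    (∀ x → c x ℕ.+ d x ≡ n) → g ℕ.+ m ≡ n → sum (map d xs) ≡ n ℕ.* m ℕ.^ k →
    (+ 1 / (n ℕ.^ k)) {{m^n≢0 n k}} * sumℚ (map (λ x → 1ℚ - (+ 1 / n) * fromℕ (c x)) xs) ≡ (1ℚ - (+ g / n)) ^ℚ k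
  [1/n^k]*Σ[1-c/n]≡[1-g/n]^k n k xs c d {g} {m} c+d≡n g+m≡n Σd≡n*m^k = begin
    (+ 1 / (n ℕ.^ k)) {{m^n≢0 n k}} * sumℚ (map (λ x → 1ℚ - u * fromℕ (c x)) xs)
      ≡⟨ cong₂ _*_ (1/[m^k]≡[1/m]^k n k) (cong sumℚ (map-cong (λ x → 1-c/n≡d/n (c x) (d x) (c+d≡n x)) xs)) ⟩
    u ^ℚ k * sumℚ (map (λ x → u * fromℕ (d x)) xs)
      ≡⟨ cong (u ^ℚ k *_) (trans (sumℚ-map-*ˡ u (fromℕ ∘ d) xs) (cong (u *_) (sumℚ-map-fromℕ d xs))) ⟩
    u ^ℚ k * (u * fromℕ (sum (map d xs)))   ≡⟨ cong (λ s → u ^ℚ k * (u * fromℕ s)) Σd≡n*m^k ⟩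
    u ^ℚ k * (u * fromℕ (n ℕ.* m ℕ.^ k))   ≡⟨ cong (u ^ℚ k *_) (1/n*[n*m]≡m n (m ℕ.^ k)) ⟩
    u ^ℚ k * fromℕ (m ℕ.^ k)               ≡⟨ cong (u ^ℚ k *_) (fromℕ-homo-^ m k) ⟩
    u ^ℚ k * fromℕ m ^ℚ k                  ≡⟨ sym (^ℚ-distrib-* u (fromℕ m) k) ⟩
    (u * fromℕ m) ^ℚ k                     ≡⟨ cong (_^ℚ k) (sym (1-c/n≡d/n g m g+m≡n)) ⟩
    (1ℚ - u * fromℕ g) ^ℚ k                ≡⟨ cong (λ q → (1ℚ - q) ^ℚ k) (sym (m/n≡1/n*m g n)) ⟩
    (1ℚ - + g / n) ^ℚ k                    ∎
    where
    open ≡-Reasoning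
    u : ℚ
    u = + 1 / n

open import Defs
open import Data.Nat using (ℕ; NonZero; _^_; _≤_)
open import Data.Nat.Properties using (m^n≢0)
open import Data.Nat.Primality using (Prime)
open import Data.Integer using (ℤ; +_)
open import Data.Rational using (ℚ; 1ℚ; _/_; _*_; _-_)
open import Data.List using (List; map)
open import Data.Vec using (Vec)
open import Relation.Binary.PropositionalEquality using (_≡_)
open ResidueCounting using (missCount; residueCount+missCount≡p; sum-missCount-minkowski)
open RationalArithmetic using ([1/n^k]*Σ[1-c/n]≡[1-g/n]^k)

lemma3p3 : (p k : ℕ) .{{_ : NonZero p}} → Prime p → 1 ≤ k → (G : List ℤ) →
    (+ 1 / (p ^ k)) {{m^n≢0 p k}} * sumℚ (map (λ h → 1ℚ - (+ 1 / p) * (+ residueCount p (minkowski (tupleSet h) G) / 1)) (tuples p k))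
      ≡ (1ℚ - (+ residueCount p G / p)) ^ℚ k
lemma3p3 p k _ _ G =
  [1/n^k]*Σ[1-c/n]≡[1-g/n]^k p k (tuples p k)
    (λ h → residueCount p (M h)) (λ h → missCount p (M h))
    (λ h → residueCount+missCount≡p p (M h))
    (residueCount+missCount≡p p G)
    (sum-missCount-minkowski p k G)
  where
  M : ∀ {n} → Vec ℕ n → List ℤ
  M h = minkowski (tupleSet h) G
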